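{- Let $E$ be a finite set, $\mathcal{L}$ a set of subsets of $E$, and suppose the toggle group $T(\mathcal{L})$ acts transitively on $\mathcal{L}$. Fix a system of blocks for $T(\mathcal{L})$, and let $\tau_y$ ($y\in E$) be a type 1 toggle. Then: (i) if $\tau_y(\mathcal{B})=\mathcal{B}$ for some block $\mathcal{B}$, then $\tau_y$ is the identity on $\mathcal{B}$; (ii) $\tau_y$ commutes with every type 2 toggle in $T(\mathcal{L})$; (iii) for any type 2 toggle $\tau$ and any blocks $\mathcal{B},\mathcal{C}$, the restrictions $\tau|_{\mathcal{B}}$ and $\tau|_{\mathcal{C}}$ have the same cycle structure.
   Context: For $e\in E$, the toggle $\tau_e:\mathcal{L}\to\mathcal{L}$ is defined by $\tau_e(X)=X\triangle\{e\}$ if $X\triangle\{e\}\in\mathcal{L}$, and $\tau_e(X)=X$ otherwise. The toggle group $T(\mathcal{L})$ is the subgroup of the symmetric group on $\mathcal{L}$ generated by $\{\tau_e: e\in E\}$. Convention: every $e\in E$ for which $\tau_e$ is the identity permutation is removed from $E$. A block for $T(\mathcal{L})$ is a subset $\mathcal{B}\subseteq\mathcal{L}$ such that for every $g\in T(\mathcal{L})$ either $g(\mathcal{B})=\mathcal{B}$ or $g(\mathcal{B})\cap\mathcal{B}=\emptyset$; a system of blocks is the partition $\{g(\mathcal{B}):g\in T(\mathcal{L})\}$ of $\mathcal{L}$ for a block $\mathcal{B}$. Relative to the fixed block system, an element $g\in T(\mathcal{L})$ is type 2 if $g(\mathcal{B})=\mathcal{B}$ for every block $\mathcal{B}$ of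 the system, and type 1 otherwise. -}

module Defs where

open import Data.Nat using (ℕ; zero; suc)
open import Data.Bool using (Bool; true; false; _∧_; not; if_then_else_; T)
import Data.Bool.Properties as BoolP
open import Data.Fin using (Fin)
open import Data.Fin.Subset using (Subset; inside; outside)
open import Data.Vec using (Vec; []; _∷_; _[_]%=_)
open import Data.Vec.Properties using (≡-dec)
open import Data.List using (List; []; _∷_; _++_; map; filter; length; upTo)
open import Data.Bool.ListAction using (any; all)
open import Data.Product using (Σ; ∃; _×_; _,_)
open import Data.Sum using (_⊎_)
open import Data.Empty using (⊥)
open import Relation.Nullary using (Dec; ¬_)
open import Relation.Nullary.Decidable using (⌊_⌋)
open import Relation.Binary.PropositionalEquality using (_≡_)

-- E = Fin n; subsets of E are Subset n; 𝓛 is given by a (Boolean) characteristic function.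
Family : ℕ → Set
Family n = Subset n → Bool

_≟S_ : ∀ {n} (X Y : Subset n) → Dec (X ≡ Y)
_≟S_ = ≡-dec BoolP._≟_

allSubsets : (n : ℕ) → List (Subset n)
allSubsets zero = [] ∷ []
allSubsets (suc n) = map (inside ∷_) (allSubsets n) ++ map (outside ∷_) (allSubsets n)

flipAt : ∀ {n} → Subset n → Fin n → Subset n
flipAt X e = X [ e ]%= not

-- the toggle τ_e (it is the identity on subsets outside 𝓛; only its action on 𝓛 matters)
toggle : ∀ {n} → Family n → Fin n → Subset n → Subset n
toggle L e X = if L X ∧ L (flipAt X e) then flipAt X e else X

-- elements of T(𝓛): compositions of toggles, given by words in E
act : ∀ {n} → Family n → List (Fin n) → Subset n → Subset n
act L [] X = X
act L (e ∷ w) X = toggle L e (act L w X)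

TransitiveAction : ∀ {n} → Family n → Set
TransitiveAction L = ∀ X Y → T (L X) → T (L Y) → ∃ λ w → act L w X ≡ Y

image : ∀ {n} → Family n → (Subset n → Subset n) → (Subset n → Bool) → Subset n → Bool
image {n} L f P Y = any (λ X → L X ∧ P X ∧ ⌊ f X ≟S Y ⌋) (allSubsets n)

Fixes : ∀ {n} → Family n → (Subset n → Subset n) → (Subset n → Bool) → Set
Fixes L f P = ∀ Y → (T (P Y) → T (image L f P Y)) × (T (image L f P Y) → T (P Y))

DisjointImage : ∀ {n} → Family n → (Subset n → Subset n) → (Subset n → Bool) → Set
DisjointImage L f P = ∀ Y → T (image L f P Y) → T (P Y) → ⊥

IsBlock : ∀ {n} → Family n → (Subset n → Bool) → Set
IsBlock L B =
  (∀ X → T (B X) → T (L X)) ×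
  (∀ (w : List _) → Fixes L (act L w) B ⊎ DisjointImage L (act L w) B)

-- the blocks of the system of blocks determined by B are g(B), g = act L w
sysBlock : ∀ {n} → Family n → (Subset n → Bool) → List (Fin n) → Subset n → Bool
sysBlock L B w = image L (act L w) B

Type2 : ∀ {n} → Family n → (Subset n → Bool) → (Subset n → Subset n) → Set
Type2 L B g = ∀ w → Fixes L g (sysBlock L B w)

iter : ∀ {n} → (Subset n → Subset n) → ℕ → Subset n → Subset n
iter f zero X = X
iter f (suc j) X = f (iter f j X)

returnsAt : ∀ {n} → (Subset n → Subset n) → Subset n → ℕ → Bool
returnsAt f X j = ⌊ iter f j X ≟S X ⌋

cycleLengthIs : ∀ {n} → (Subset n → Subset n) → Subset n → ℕ → Bool
cycleLengthIs f X zero = false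
cycleLengthIs f X (suc k) =
  returnsAt f X (suc k) ∧ all (λ j → not (returnsAt f X (suc j))) (upTo k)

cycleCount : ∀ {n} → (Subset n → Subset n) → (Subset n → Bool) → ℕ → ℕ
cycleCount {n} f C k = length (filter (λ X → BoolP.T? (C X ∧ cycleLengthIs f X k)) (allSubsets n))

-- By the block property a toggle τ_d either maps a block into itself ("stabilizes" it) or maps
-- it onto a disjoint block; in the second case τ_d moves every X of the block to X △ {d}, and
-- it then commutes with a toggle τ_e that keeps the blocks in place, both composites being
-- X △ {d, e}.  Any block is reached from any other by a word of toggles, in which the
-- stabilizing letters do not change the block and the others commute with the toggle under
-- study.  Along such a word one transports a point that τ_y moves inside a block, which makes
-- τ_y type 2 and gives (i); and for type 2 τ_e one builds a word v carrying one block onto the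
-- other with v τ_e = τ_e v there, which gives (iii).  For (ii), τ_y is the identity on the
-- blocks it stabilizes by (i), and commutes with τ_e on the blocks it leaves.
module Submission where

open import Defs
open import Data.Nat using (ℕ; zero; suc)
open import Data.Bool using (Bool; true; false; _∧_; not; T)
open import Data.Bool.Properties using (T?; T-∧; not-involutive)
open import Data.Bool.ListAction using (and)
open import Data.Unit using (tt)
open import Data.Fin using (Fin; zero; suc)
open import Data.Fin.Subset using (Subset; inside; outside)
open import Data.Fin.Subset.Properties using (anySubset?)
open import Data.Vec using ([]; _∷_)
open import Data.Vec.Properties using (∷-injectiveʳ)
open import Data.List using (List; []; _∷_; _++_; [_]; map; filter; length; reverse; upTo)
open import Data.List.Properties using (length-map; unfold-reverse; reverse-involutive; filter-≐; map-cong)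
open import Data.List.Membership.Propositional using (_∈_; lose)
open import Data.List.Membership.Propositional.Properties using (∈-map⁺; ∈-map⁻; ∈-++⁺ˡ; ∈-++⁺ʳ)
open import Data.List.Membership.Propositional.Properties.WithK using (unique∧set⇒bag)
open import Data.List.Relation.Unary.Any using (here; satisfied)
open import Data.List.Relation.Unary.Any.Properties using (any⁺; any⁻)
open import Data.List.Relation.Unary.Unique.Propositional using (Unique)
import Data.List.Relation.Unary.Unique.Propositional.Properties as Unique
import Data.List.Relation.Unary.AllPairs as AllPairs
import Data.List.Relation.Unary.All as All
open import Data.List.Relation.Binary.Permutation.Propositional using (_↭_)
open import Data.List.Relation.Binary.Permutation.Propositional.Properties using (↭-length; filter-↭)
open import Data.List.Relation.Binary.BagAndSetEquality using (∼bag⇒↭)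
open import Data.Product using (∃; _×_; _,_; proj₁; proj₂)
open import Data.Sum using (inj₁; inj₂)
open import Data.Empty using (⊥; ⊥-elim)
open import Function using (_∘_; id)
open import Function.Bundles using (mk⇔; Equivalence)
open import Relation.Nullary using (Dec; does; yes; no; ¬_; _×-dec_)
open import Relation.Nullary.Decidable using (⌊_⌋; map′; toWitness; fromWitness)
open import Relation.Unary using (Pred; Decidable; _≐_)
open import Relation.Binary.PropositionalEquality using (_≡_; _≢_; refl; sym; trans; cong; cong₂; subst; module ≡-Reasoning)
open ≡-Reasoning

flipAt-involutive : ∀ {n} (X : Subset n) e → flipAt (flipAt X e) e ≡ X
flipAt-involutive (x ∷ X) zero = cong (_∷ X) (not-involutive x)
flipAt-involutive (x ∷ X) (suc e) = cong (x ∷_) (flipAt-involutive X e)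

flipAt-comm : ∀ {n} (X : Subset n) d e → flipAt (flipAt X d) e ≡ flipAt (flipAt X e) d
flipAt-comm (x ∷ X) zero zero = refl
flipAt-comm (x ∷ X) zero (suc e) = refl
flipAt-comm (x ∷ X) (suc d) zero = refl
flipAt-comm (x ∷ X) (suc d) (suc e) = cong (x ∷_) (flipAt-comm X d e)

flipAt-≢ : ∀ {n} (X : Subset n) e → flipAt X e ≢ X
flipAt-≢ (true ∷ X) zero ()
flipAt-≢ (false ∷ X) zero ()
flipAt-≢ (x ∷ X) (suc e) eq = flipAt-≢ X e (∷-injectiveʳ eq)

∈-allSubsets : ∀ {n} (X : Subset n) → X ∈ allSubsets n
∈-allSubsets [] = here refl
∈-allSubsets {suc n} (true ∷ X) = ∈-++⁺ˡ (∈-map⁺ (inside ∷_) (∈-allSubsets X))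
∈-allSubsets {suc n} (false ∷ X) =
  ∈-++⁺ʳ (map (inside ∷_) (allSubsets n)) (∈-map⁺ (outside ∷_) (∈-allSubsets X))

allSubsets-unique : ∀ n → Unique (allSubsets n)
allSubsets-unique zero = All.[] AllPairs.∷ AllPairs.[]
allSubsets-unique (suc n) =
  Unique.++⁺ (Unique.map⁺ ∷-injectiveʳ (allSubsets-unique n))
             (Unique.map⁺ ∷-injectiveʳ (allSubsets-unique n)) disjoint
  where
  disjoint : ∀ {X} → X ∈ map (inside ∷_) (allSubsets n) × X ∈ map (outside ∷_) (allSubsets n) → ⊥
  disjoint (p , q) with ∈-map⁻ (inside ∷_) p | ∈-map⁻ (outside ∷_) q
  ... | _ , _ , refl | _ , _ , ()

map-allSubsets-↭ : ∀ {n} (h g : Subset n → Subset n) →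
  (∀ X → g (h X) ≡ X) → (∀ X → h (g X) ≡ X) → map h (allSubsets n) ↭ allSubsets n
map-allSubsets-↭ {n} h g gh hg = ∼bag⇒↭ (unique∧set⇒bag
  (Unique.map⁺ h-injective (allSubsets-unique n)) (allSubsets-unique n)
  (λ {X} → mk⇔ (λ _ → ∈-allSubsets X)
                (λ _ → subst (_∈ map h (allSubsets n)) (hg X) (∈-map⁺ h (∈-allSubsets (g X))))))
  where
  h-injective : ∀ {X Y} → h X ≡ h Y → X ≡ Y
  h-injective {X} {Y} eq = trans (sym (gh X)) (trans (cong g eq) (gh Y))

filter-map : ∀ {A B : Set} {p} {P : Pred B p} (P? : Decidable P) (h : A → B) xs →
  filter P? (map h xs) ≡ map h (filter (P? ∘ h) xs)
filter-map P? h [] = refl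
filter-map P? h (x ∷ xs) with does (P? (h x))
... | true = cong (h x ∷_) (filter-map P? h xs)
... | false = filter-map P? h xs

countSubsets : ∀ {n} → (Subset n → Bool) → ℕ
countSubsets {n} p = length (filter (T? ∘ p) (allSubsets n))

countSubsets-bijection : ∀ {n} (h g : Subset n → Subset n) →
  (∀ X → g (h X) ≡ X) → (∀ X → h (g X) ≡ X) →
  (p q : Subset n → Bool) → (∀ X → p X ≡ q (h X)) → countSubsets p ≡ countSubsets q
countSubsets-bijection {n} h g gh hg p q p≡q∘h = begin
  length (filter (T? ∘ p) all)                 ≡⟨ cong length (filter-≐ (T? ∘ p) (T? ∘ q ∘ h) p≐q∘h all) ⟩
  length (filter (T? ∘ q ∘ h) all)             ≡⟨ sym (length-map h (filter (T? ∘ q ∘ h) all)) ⟩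
  length (map h (filter (T? ∘ q ∘ h) all))     ≡⟨ cong length (sym (filter-map (T? ∘ q) h all)) ⟩
  length (filter (T? ∘ q) (map h all))         ≡⟨ ↭-length (filter-↭ (T? ∘ q) (map-allSubsets-↭ h g gh hg)) ⟩
  length (filter (T? ∘ q) all)                 ∎
  where
  all = allSubsets n
  p≐q∘h : (T ∘ p) ≐ (T ∘ q ∘ h)
  p≐q∘h = (λ {X} → subst T (p≡q∘h X)) , (λ {X} → subst T (sym (p≡q∘h X)))

∧-cong-T : ∀ {a a′ b b′} → (T a → T a′) → (T a′ → T a) → (T a → b ≡ b′) → a ∧ b ≡ a′ ∧ b′
∧-cong-T {false} {false} _ _ _ = refl
∧-cong-T {true} {true} _ _ b≡b′ = b≡b′ tt
∧-cong-T {true} {false} a→a′ _ _ = ⊥-elim (a→a′ tt)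
∧-cong-T {false} {true} _ a′→a _ = ⊥-elim (a′→a tt)

⌊⌋-cong : ∀ {A B : Set} (a? : Dec A) (b? : Dec B) → (A → B) → (B → A) → ⌊ a? ⌋ ≡ ⌊ b? ⌋
⌊⌋-cong (yes _) (yes _) _ _ = refl
⌊⌋-cong (no _) (no _) _ _ = refl
⌊⌋-cong (yes a) (no ¬b) a→b _ = ⊥-elim (¬b (a→b a))
⌊⌋-cong (no ¬a) (yes b) _ b→a = ⊥-elim (¬a (b→a b))

iter-conj : ∀ {n} (S : Subset n → Set) (f h : Subset n → Subset n) →
  (∀ {Y} → S Y → S (f Y)) → (∀ {Y} → S Y → h (f Y) ≡ f (h Y)) →
  ∀ {X} → S X → ∀ j → h (iter f j X) ≡ iter f j (h X)
iter-conj S f h f-closed comm sx zero = refl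
iter-conj S f h f-closed comm {X} sx (suc j) = begin
  h (f (iter f j X))   ≡⟨ comm (iter-closed j) ⟩
  f (h (iter f j X))   ≡⟨ cong f (iter-conj S f h f-closed comm sx j) ⟩
  f (iter f j (h X))   ∎
  where
  iter-closed : ∀ j → S (iter f j X)
  iter-closed zero = sx
  iter-closed (suc j) = f-closed (iter-closed j)

module _ {n} (f h : Subset n → Subset n) (h-injective : ∀ {X Y} → h X ≡ h Y → X ≡ Y) where

  returnsAt-conj : ∀ {X} j → h (iter f j X) ≡ iter f j (h X) →
    returnsAt f (h X) j ≡ returnsAt f X j
  returnsAt-conj {X} j comm = ⌊⌋-cong (iter f j (h X) ≟S h X) (iter f j X ≟S X)
    (λ eq → h-injective (trans comm eq)) (λ eq → trans (sym comm) (cong h eq))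

  cycleLengthIs-conj : ∀ {X} → (∀ j → h (iter f j X) ≡ iter f j (h X)) →
    ∀ k → cycleLengthIs f (h X) k ≡ cycleLengthIs f X k
  cycleLengthIs-conj comm zero = refl
  cycleLengthIs-conj comm (suc k) = cong₂ _∧_ (returnsAt-conj (suc k) (comm (suc k)))
    (cong and (map-cong (λ j → cong not (returnsAt-conj (suc j) (comm (suc j)))) (upTo k)))

module Action {n} (L : Family n) where

  data ToggleView (X : Subset n) (e : Fin n) : Set where
    flips : T (L X) → T (L (flipAt X e)) → toggle L e X ≡ flipAt X e → ToggleView X e
    stays : toggle L e X ≡ X → ToggleView X e

  toggle-flip : ∀ {X} e → T (L X) → T (L (flipAt X e)) → toggle L e X ≡ flipAt X e
  toggle-flip {X} e lx lfx with L X | L (flipAt X e)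
  ... | true | true = refl

  toggle-stay : ∀ {X} e → ¬ (T (L X) × T (L (flipAt X e))) → toggle L e X ≡ X
  toggle-stay {X} e ¬both with L X | L (flipAt X e)
  ... | true | true = ⊥-elim (¬both (tt , tt))
  ... | true | false = refl
  ... | false | _ = refl

  toggleView : ∀ X e → ToggleView X e
  toggleView X e with T? (L X) ×-dec T? (L (flipAt X e))
  ... | yes (lx , lfx) = flips lx lfx (toggle-flip e lx lfx)
  ... | no ¬both = stays (toggle-stay e ¬both)

  toggle-involutive : ∀ X e → toggle L e (toggle L e X) ≡ X
  toggle-involutive X e with toggleView X e
  ... | stays eq = trans (cong (toggle L e) eq) eq
  ... | flips lx lfx eq = begin
    toggle L e (toggle L e X)   ≡⟨ cong (toggle L e) eq ⟩
    toggle L e (flipAt X e)     ≡⟨ toggle-flip e lfx (subst (T ∘ L) (sym (flipAt-involutive X e)) lx) ⟩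
    flipAt (flipAt X e) e       ≡⟨ flipAt-involutive X e ⟩
    X                           ∎

  toggle-∈ : ∀ {X} e → T (L X) → T (L (toggle L e X))
  toggle-∈ {X} e lx with toggleView X e
  ... | stays eq = subst (T ∘ L) (sym eq) lx
  ... | flips _ lfx eq = subst (T ∘ L) (sym eq) lfx

  toggle-≢⇒flipAt-∈ : ∀ {X} e → toggle L e X ≢ X → T (L (flipAt X e))
  toggle-≢⇒flipAt-∈ {X} e moved with toggleView X e
  ... | flips _ lfx _ = lfx
  ... | stays eq = ⊥-elim (moved eq)

  toggles-commute-on-square : ∀ {Z} d e → T (L Z) → T (L (flipAt Z d)) → T (L (flipAt Z e)) →
    T (L (flipAt (flipAt Z e) d)) → toggle L d (toggle L e Z) ≡ toggle L e (toggle L d Z)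
  toggles-commute-on-square {Z} d e lz lzd lze lzed = begin
    toggle L d (toggle L e Z)   ≡⟨ cong (toggle L d) (toggle-flip e lz lze) ⟩
    toggle L d (flipAt Z e)     ≡⟨ toggle-flip d lze lzed ⟩
    flipAt (flipAt Z e) d       ≡⟨ flipAt-comm Z e d ⟩
    flipAt (flipAt Z d) e       ≡⟨ sym (toggle-flip e lzd (subst (T ∘ L) (flipAt-comm Z e d) lzed)) ⟩
    toggle L e (flipAt Z d)     ≡⟨ cong (toggle L e) (sym (toggle-flip d lz lzd)) ⟩
    toggle L e (toggle L d Z)   ∎

  act-++ : ∀ u v X → act L (u ++ v) X ≡ act L u (act L v X)
  act-++ [] v X = refl
  act-++ (e ∷ u) v X = cong (toggle L e) (act-++ u v X)

  act-∈ : ∀ w {X} → T (L X) → T (L (act L w X))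
  act-∈ [] lx = lx
  act-∈ (e ∷ w) lx = toggle-∈ e (act-∈ w lx)

  act-reverseˡ : ∀ w X → act L (reverse w) (act L w X) ≡ X
  act-reverseˡ [] X = refl
  act-reverseˡ (e ∷ w) X = begin
    act L (reverse (e ∷ w)) eX                ≡⟨ cong (λ u → act L u eX) (unfold-reverse e w) ⟩
    act L (reverse w ++ [ e ]) eX             ≡⟨ act-++ (reverse w) [ e ] eX ⟩
    act L (reverse w) (toggle L e eX)         ≡⟨ cong (act L (reverse w)) (toggle-involutive _ e) ⟩
    act L (reverse w) (act L w X)             ≡⟨ act-reverseˡ w X ⟩
    X                                         ∎
    where eX = toggle L e (act L w X)

  act-reverseʳ : ∀ w X → act L w (act L (reverse w) X) ≡ X
  act-reverseʳ w X =
    subst (λ u → act L u (act L (reverse w) X) ≡ X) (reverse-involutive w) (act-reverseˡ (reverse w) X)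

  act-injective : ∀ w {X Y} → act L w X ≡ act L w Y → X ≡ Y
  act-injective w {X} {Y} eq = begin
    X                                ≡⟨ sym (act-reverseˡ w X) ⟩
    act L (reverse w) (act L w X)    ≡⟨ cong (act L (reverse w)) eq ⟩
    act L (reverse w) (act L w Y)    ≡⟨ act-reverseˡ w Y ⟩
    Y                                ∎

  image-intro : ∀ (f : Subset n → Subset n) P {X Y} → T (L X) → T (P X) → f X ≡ Y → T (image L f P Y)
  image-intro f P {X} lx px eq = any⁺ _ (lose (∈-allSubsets X)
    (Equivalence.from T-∧ (lx , Equivalence.from T-∧ (px , fromWitness eq))))

  image-elim : ∀ (f : Subset n → Subset n) P {Y} → T (image L f P Y) → ∃ λ X → T (L X) × T (P X) × f X ≡ Y
  image-elim f P {Y} h with satisfied (any⁻ _ (allSubsets n) h)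
  ... | X , q with Equivalence.to T-∧ q
  ... | lx , q′ with Equivalence.to T-∧ q′
  ... | px , eq = X , lx , px , toWitness eq

module Blocks {n} (L : Family n) (B : Subset n → Bool) (isBlock : IsBlock L B) where
  open Action L

  B⊆L : ∀ {X} → T (B X) → T (L X)
  B⊆L = proj₁ isBlock _

  B-act : ∀ g {X Y} → T (B X) → T (B Y) → T (B (act L g X)) → T (B (act L g Y))
  B-act g bx by bgx with proj₂ isBlock g
  ... | inj₁ fixes = proj₂ (fixes _) (image-intro (act L g) B (B⊆L by) by refl)
  ... | inj₂ disjoint = ⊥-elim (disjoint _ (image-intro (act L g) B (B⊆L bx) bx refl) bgx)

  InBlock : List (Fin n) → Subset n → Set
  InBlock w Y = T (sysBlock L B w Y)

  inBlock : ∀ w {X} → T (B X) → InBlock w (act L w X)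
  inBlock w bx = image-intro (act L w) B (B⊆L bx) bx refl

  inBlock-elim : ∀ w {Y} → InBlock w Y → ∃ λ X → T (B X) × act L w X ≡ Y
  inBlock-elim w hy with image-elim (act L w) B hy
  ... | X , _ , bx , eq = X , bx , eq

  inBlock-∈ : ∀ w {Y} → InBlock w Y → T (L Y)
  inBlock-∈ w hy with inBlock-elim w hy
  ... | X , bx , refl = act-∈ w (B⊆L bx)

  -- Conjugating u by the words of the two blocks reduces this to the block property of B.
  inBlock-act : ∀ w w′ u {X Y} → InBlock w X → InBlock w Y →
    InBlock w′ (act L u X) → InBlock w′ (act L u Y)
  inBlock-act w w′ u hx hy hux with inBlock-elim w hx | inBlock-elim w hy | inBlock-elim w′ hux
  ... | X₀ , bx , refl | Y₀ , by , refl | Z₀ , bz , ez =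
    subst (InBlock w′) gY≡uY (inBlock w′ (B-act g bx by (subst (T ∘ B) (sym gX≡Z) bz)))
    where
    g = reverse w′ ++ (u ++ w)
    gX≡Z : act L g X₀ ≡ Z₀
    gX≡Z = begin
      act L g X₀                                 ≡⟨ act-++ (reverse w′) (u ++ w) X₀ ⟩
      act L (reverse w′) (act L (u ++ w) X₀)     ≡⟨ cong (act L (reverse w′)) (act-++ u w X₀) ⟩
      act L (reverse w′) (act L u (act L w X₀))  ≡⟨ cong (act L (reverse w′)) (sym ez) ⟩
      act L (reverse w′) (act L w′ Z₀)           ≡⟨ act-reverseˡ w′ Z₀ ⟩
      Z₀                                         ∎
    gY≡uY : act L w′ (act L g Y₀) ≡ act L u (act L w Y₀)
    gY≡uY = begin
      act L w′ (act L g Y₀)                              ≡⟨ cong (act L w′) (act-++ (reverse w′) (u ++ w) Y₀) ⟩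
      act L w′ (act L (reverse w′) (act L (u ++ w) Y₀))  ≡⟨ act-reverseʳ w′ _ ⟩
      act L (u ++ w) Y₀                                  ≡⟨ act-++ u w Y₀ ⟩
      act L u (act L w Y₀)                               ∎

  inBlock-∷ : ∀ d u {Z} → InBlock u Z → InBlock (d ∷ u) (toggle L d Z)
  inBlock-∷ d u hz with inBlock-elim u hz
  ... | Z₀ , bz , refl = inBlock (d ∷ u) bz

  inBlock-∷⁻ : ∀ d u {Y} → InBlock (d ∷ u) Y → InBlock u (toggle L d Y)
  inBlock-∷⁻ d u hy with inBlock-elim (d ∷ u) hy
  ... | Y₀ , by , refl = subst (InBlock u) (sym (toggle-involutive _ d)) (inBlock u by)

  inBlock-cancel : ∀ w w′ {Y} → InBlock ((w′ ++ reverse w) ++ w) Y → InBlock w′ Y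
  inBlock-cancel w w′ hy with inBlock-elim ((w′ ++ reverse w) ++ w) hy
  ... | Y₀ , by , refl = subst (InBlock w′) (sym cancel) (inBlock w′ by)
    where
    cancel : act L ((w′ ++ reverse w) ++ w) Y₀ ≡ act L w′ Y₀
    cancel = begin
      act L ((w′ ++ reverse w) ++ w) Y₀          ≡⟨ act-++ (w′ ++ reverse w) w Y₀ ⟩
      act L (w′ ++ reverse w) (act L w Y₀)       ≡⟨ act-++ w′ (reverse w) _ ⟩
      act L w′ (act L (reverse w) (act L w Y₀))  ≡⟨ cong (act L w′) (act-reverseˡ w Y₀) ⟩
      act L w′ Y₀                                ∎

  data Stabilizes (d : Fin n) (u : List (Fin n)) : Set where
    stabilizedAt : ∀ {Z} → InBlock u Z → InBlock u (toggle L d Z) → Stabilizes d u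

  stabilizes? : ∀ d u → Dec (Stabilizes d u)
  stabilizes? d u =
    map′ (λ (_ , hz , hdz) → stabilizedAt hz hdz) (λ { (stabilizedAt hz hdz) → _ , hz , hdz })
    (anySubset? (λ Z → T? (sysBlock L B u Z) ×-dec T? (sysBlock L B u (toggle L d Z))))

  stabilizes-maps : ∀ {d u} → Stabilizes d u → ∀ {Y} → InBlock u Y → InBlock u (toggle L d Y)
  stabilizes-maps {d} {u} (stabilizedAt hz hdz) hy = inBlock-act u u [ d ] hz hy hdz

  stabilizes-∷ : ∀ {d u} → Stabilizes d u → ∀ {Y} → InBlock u Y → InBlock (d ∷ u) Y
  stabilizes-∷ {d} {u} s {Y} hy =
    subst (InBlock (d ∷ u)) (toggle-involutive Y d) (inBlock-∷ d u (stabilizes-maps s hy))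

  stabilizes-∷⁻ : ∀ {d u} → Stabilizes d (d ∷ u) → Stabilizes d u
  stabilizes-∷⁻ {d} {u} (stabilizedAt hz hdz) = stabilizedAt (inBlock-∷⁻ d u hz) (inBlock-∷⁻ d u hdz)

  fixes⇒stabilizes : ∀ {d u X} → Fixes L (toggle L d) (sysBlock L B u) → InBlock u X → Stabilizes d u
  fixes⇒stabilizes {d} {u} {X} fixes hx =
    stabilizedAt hx (proj₂ (fixes _) (image-intro (toggle L d) (sysBlock L B u) (inBlock-∈ u hx) hx refl))

  stabilizes⇒fixes : ∀ {d u} → Stabilizes d u → Fixes L (toggle L d) (sysBlock L B u)
  stabilizes⇒fixes {d} {u} s Y = into , back
    where
    into : InBlock u Y → T (image L (toggle L d) (sysBlock L B u) Y)
    into hy = image-intro (toggle L d) (sysBlock L B u) (inBlock-∈ u hdy) hdy (toggle-involutive Y d)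
      where hdy = stabilizes-maps s hy
    back : T (image L (toggle L d) (sysBlock L B u) Y) → InBlock u Y
    back hy with image-elim (toggle L d) (sysBlock L B u) hy
    ... | X , _ , hx , refl = stabilizes-maps s hx

  leaving-flips : ∀ {d u Z} → ¬ Stabilizes d u → InBlock u Z → T (L (flipAt Z d)) × toggle L d Z ≡ flipAt Z d
  leaving-flips {d} {u} {Z} leaves hz with toggleView Z d
  ... | flips _ lzd eq = lzd , eq
  ... | stays eq = ⊥-elim (leaves (stabilizedAt hz (subst (InBlock u) (sym eq) hz)))

  type2-maps : ∀ {e} → Type2 L B (toggle L e) → ∀ u {Z} → InBlock u Z → InBlock u (toggle L e Z)
  type2-maps {e} t2 u hz =
    proj₂ (t2 u _) (image-intro (toggle L e) (sysBlock L B u) (inBlock-∈ u hz) hz refl)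

  -- The word w′ ++ reverse w leads from block w to block w′, and a letter stabilizing the
  -- current block does not change it.
  block-induction : (P : List (Fin n) → Set) →
    (∀ u u′ → (∀ {Y} → InBlock u Y → InBlock u′ Y) → P u → P u′) →
    (∀ d u → ¬ Stabilizes d u → P u → P (d ∷ u)) →
    ∀ w → P w → ∀ w′ → P w′
  block-induction P mono leave w pw w′ = mono _ w′ (inBlock-cancel w w′) (along (w′ ++ reverse w))
    where
    along : ∀ g → P (g ++ w)
    along [] = pw
    along (d ∷ g) with stabilizes? d (g ++ w)
    ... | yes s = mono (g ++ w) (d ∷ g ++ w) (stabilizes-∷ s) (along g)
    ... | no leaves = leave d (g ++ w) leaves (along g)

  leaving-commutes-moving : ∀ {d e} u {Z} → ¬ Stabilizes d u → InBlock u Z → InBlock u (toggle L e Z) →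
    T (L (flipAt Z e)) → toggle L d (toggle L e Z) ≡ toggle L e (toggle L d Z)
  leaving-commutes-moving {d} {e} u {Z} leaves hz hez lze =
    toggles-commute-on-square d e lz (proj₁ (leaving-flips leaves hz)) lze lzed
    where
    lz = inBlock-∈ u hz
    lzed : T (L (flipAt (flipAt Z e) d))
    lzed = subst (λ V → T (L (flipAt V d))) (toggle-flip e lz lze) (proj₁ (leaving-flips leaves hez))

  -- If τ_e moved Z′ = τ_d Z to W, then τ_d W = W would make τ_d stabilize the block of Z′,
  -- and τ_d W = W △ {d} = Z △ {e} would make τ_e move Z.
  type2-fixes-after-leaving : ∀ {d e} u {Z} → Type2 L B (toggle L e) → ¬ Stabilizes d u → InBlock u Z →
    toggle L e Z ≡ Z → toggle L e (toggle L d Z) ≡ toggle L d Z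
  type2-fixes-after-leaving {d} {e} u {Z} t2 leaves hz eZ≡Z with toggleView (toggle L d Z) e
  ... | stays eq = eq
  ... | flips _ _ eqW = ⊥-elim (W-absurd (toggleView W d))
    where
    W = flipAt (toggle L d Z) e
    hW : InBlock (d ∷ u) W
    hW = subst (InBlock (d ∷ u)) eqW (type2-maps t2 (d ∷ u) (inBlock-∷ d u hz))
    dW≡eZ : flipAt W d ≡ flipAt Z e
    dW≡eZ = begin
      flipAt (flipAt (toggle L d Z) e) d  ≡⟨ cong (λ V → flipAt (flipAt V e) d) (proj₂ (leaving-flips leaves hz)) ⟩
      flipAt (flipAt (flipAt Z d) e) d    ≡⟨ flipAt-comm (flipAt Z d) e d ⟩
      flipAt (flipAt (flipAt Z d) d) e    ≡⟨ cong (λ V → flipAt V e) (flipAt-involutive Z d) ⟩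
      flipAt Z e                          ∎
    W-absurd : ToggleView W d → ⊥
    W-absurd (stays dW≡W) = leaves (stabilizes-∷⁻ (stabilizedAt hW (subst (InBlock (d ∷ u)) (sym dW≡W) hW)))
    W-absurd (flips _ lWd _) =
      flipAt-≢ Z e (trans (sym (toggle-flip e (inBlock-∈ u hz) (subst (T ∘ L) dW≡eZ lWd))) eZ≡Z)

  type2-commutes-leaving : ∀ {d e} u {Z} → Type2 L B (toggle L e) → ¬ Stabilizes d u → InBlock u Z →
    toggle L d (toggle L e Z) ≡ toggle L e (toggle L d Z)
  type2-commutes-leaving {d} {e} u {Z} t2 leaves hz with toggleView Z e
  ... | flips _ lze _ = leaving-commutes-moving u leaves hz (type2-maps t2 u hz) lze
  ... | stays eZ≡Z = begin
    toggle L d (toggle L e Z)  ≡⟨ cong (toggle L d) eZ≡Z ⟩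
    toggle L d Z               ≡⟨ sym (type2-fixes-after-leaving u t2 leaves hz eZ≡Z) ⟩
    toggle L e (toggle L d Z)  ∎

  MovesWithin : Fin n → List (Fin n) → Set
  MovesWithin y u = ∃ λ Z → InBlock u Z × InBlock u (toggle L y Z) × toggle L y Z ≢ Z

  movesWithin⇒type2 : ∀ y w → MovesWithin y w → Type2 L B (toggle L y)
  movesWithin⇒type2 y w m w′ = fixes (block-induction (MovesWithin y) mono leave w m w′)
    where
    mono : ∀ u u′ → (∀ {Y} → InBlock u Y → InBlock u′ Y) → MovesWithin y u → MovesWithin y u′
    mono _ _ u⊆u′ (Z , hz , hyz , moved) = Z , u⊆u′ hz , u⊆u′ hyz , moved
    leave : ∀ d u → ¬ Stabilizes d u → MovesWithin y u → MovesWithin y (d ∷ u)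
    leave d u leaves (Z , hz , hyz , moved) =
      toggle L d Z , inBlock-∷ d u hz , subst (InBlock (d ∷ u)) commute (inBlock-∷ d u hyz) ,
      λ eq → moved (act-injective [ d ] (trans commute eq))
      where
      commute : toggle L d (toggle L y Z) ≡ toggle L y (toggle L d Z)
      commute = leaving-commutes-moving u leaves hz hyz (toggle-≢⇒flipAt-∈ y moved)
    fixes : MovesWithin y w′ → Fixes L (toggle L y) (sysBlock L B w′)
    fixes (Z , hz , hyz , _) = stabilizes⇒fixes (stabilizedAt {u = w′} hz hyz)

  type1-fixes-stabilized-block : ∀ {y} u {X} → ¬ Type2 L B (toggle L y) → Stabilizes y u → InBlock u X →
    toggle L y X ≡ X
  type1-fixes-stabilized-block {y} u {X} type1 s hx with toggle L y X ≟S X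
  ... | yes fixed = fixed
  ... | no moved = ⊥-elim (type1 (movesWithin⇒type2 y u (X , hx , stabilizes-maps s hx , moved)))

  -- IsBlock allows B to be empty, and then every permutation is (vacuously) of type 2.
  emptyBlock⇒type2 : (¬ ∃ λ X → T (B X)) → ∀ g → Type2 L B g
  emptyBlock⇒type2 noB g w Y = ⊥-elim ∘ notInBlock , ⊥-elim ∘ notInImage
    where
    notInBlock : ∀ {Y} → InBlock w Y → ⊥
    notInBlock hy with inBlock-elim w hy
    ... | X , bx , _ = noB (X , bx)
    notInImage : T (image L g (sysBlock L B w) Y) → ⊥
    notInImage hy with image-elim g (sysBlock L B w) hy
    ... | _ , _ , hx , _ = notInBlock hx

  type1-commutes-type2-on-block : ∀ {y e} u {X} → ¬ Type2 L B (toggle L y) → Type2 L B (toggle L e) →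
    InBlock u X → toggle L y (toggle L e X) ≡ toggle L e (toggle L y X)
  type1-commutes-type2-on-block {y} {e} u {X} type1 t2 hx with stabilizes? y u
  ... | no leaves = type2-commutes-leaving u t2 leaves hx
  ... | yes s = begin
    toggle L y (toggle L e X)  ≡⟨ type1-fixes-stabilized-block u type1 s (type2-maps t2 u hx) ⟩
    toggle L e X               ≡⟨ cong (toggle L e) (sym (type1-fixes-stabilized-block u type1 s hx)) ⟩
    toggle L e (toggle L y X)  ∎

  type1-commutes-type2 : TransitiveAction L → ∀ {y e} → ¬ Type2 L B (toggle L y) → Type2 L B (toggle L e) →
    ∀ {X} → T (L X) → toggle L y (toggle L e X) ≡ toggle L e (toggle L y X)
  type1-commutes-type2 transitive {y} type1 t2 {X} lx with anySubset? (T? ∘ B)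
  ... | no noB = ⊥-elim (type1 (emptyBlock⇒type2 noB (toggle L y)))
  ... | yes (X₀ , bx₀) with transitive X₀ X (B⊆L bx₀) lx
  ... | w , refl = type1-commutes-type2-on-block w type1 t2 (inBlock w bx₀)

  Conjugates : Fin n → List (Fin n) → List (Fin n) → Set
  Conjugates e w w′ = ∃ λ v → (∀ {X} → InBlock w X → InBlock w′ (act L v X)) ×
                              (∀ {X} → InBlock w X → act L v (toggle L e X) ≡ toggle L e (act L v X))

  type2-conjugates : ∀ {e} → Type2 L B (toggle L e) → ∀ w w′ → Conjugates e w w′
  type2-conjugates {e} t2 w = block-induction (Conjugates e w) mono leave w ([] , id , λ _ → refl)
    where
    mono : ∀ u u′ → (∀ {Y} → InBlock u Y → InBlock u′ Y) → Conjugates e w u → Conjugates e w u′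
    mono _ _ u⊆u′ (v , maps , commute) = v , u⊆u′ ∘ maps , commute
    leave : ∀ d u → ¬ Stabilizes d u → Conjugates e w u → Conjugates e w (d ∷ u)
    leave d u leaves (v , maps , commute) = d ∷ v , inBlock-∷ d u ∘ maps ,
      λ hx → trans (cong (toggle L d) (commute hx)) (type2-commutes-leaving u t2 leaves (maps hx))

  act-reflects-block : ∀ w w′ v → (∀ {X} → InBlock w X → InBlock w′ (act L v X)) →
    ∀ {X} → InBlock w′ (act L v X) → InBlock w X
  act-reflects-block w w′ v maps {X} hvx with inBlock-elim w′ hvx
  ... | Y₀ , by₀ , _ = subst (InBlock w) (act-reverseˡ v X)
    (inBlock-act w′ w (reverse v) (maps hx₁) hvx (subst (InBlock w) (sym (act-reverseˡ v _)) hx₁))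
    where hx₁ = inBlock w by₀

  type2-cycleCount : ∀ {e} → Type2 L B (toggle L e) → ∀ w₁ w₂ k →
    cycleCount (toggle L e) (sysBlock L B w₁) k ≡ cycleCount (toggle L e) (sysBlock L B w₂) k
  type2-cycleCount {e} t2 w₁ w₂ k with type2-conjugates t2 w₁ w₂
  ... | v , maps , commute =
    countSubsets-bijection (act L v) (act L (reverse v)) (act-reverseˡ v) (act-reverseʳ v) _ _ sameCycles
    where
    τ = toggle L e
    sameCycles : ∀ X → (sysBlock L B w₁ X ∧ cycleLengthIs τ X k) ≡
                       (sysBlock L B w₂ (act L v X) ∧ cycleLengthIs τ (act L v X) k)
    sameCycles X = ∧-cong-T maps (act-reflects-block w₁ w₂ v maps) λ hx →
      sym (cycleLengthIs-conj τ (act L v) (act-injective v)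
             (iter-conj (InBlock w₁) τ (act L v) (type2-maps t2 w₁) commute hx) k)

lemma2p2 : ∀ {n} (L : Family n) → TransitiveAction L →
    (B : Subset n → Bool) → IsBlock L B →
    (y : Fin n) → ¬ Type2 L B (toggle L y) →
    (∀ w → Fixes L (toggle L y) (sysBlock L B w) →
       ∀ X → T (sysBlock L B w X) → toggle L y X ≡ X)
    × (∀ e → Type2 L B (toggle L e) →
       ∀ X → T (L X) → toggle L y (toggle L e X) ≡ toggle L e (toggle L y X))
    × (∀ e → Type2 L B (toggle L e) → ∀ w₁ w₂ k →
       cycleCount (toggle L e) (sysBlock L B w₁) k ≡ cycleCount (toggle L e) (sysBlock L B w₂) k)
lemma2p2 L transitive B isBlock y type1 =
    (λ w fixes X hx → type1-fixes-stabilized-block w type1 (fixes⇒stabilizes fixes hx) hx)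
  , (λ e t2 X lx → type1-commutes-type2 transitive type1 t2 lx)
  , (λ e t2 → type2-cycleCount t2)
  where open Blocks L B isBlock
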